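{- The fractional cost of the adjusted correlation metric $f$ in the $\ell_\infty$-norm objective is at most $56\cdot\mathsf{OPT}(\infty)$, i.e. for every $u\in V$, $$\sum_{v\in N_u^+} f_{uv}+\sum_{v\in N_u^- }(1-f_{uv})\le 56\cdot \mathsf{OPT}(\infty).$$
   Context: $G=(V,E)$ is a complete graph with every edge labeled positive or negative; every vertex has a positive self-loop. $N_u^+$ ($N_u^-$) is the set of $v$ with $(u,v)$ positive (negative), and $\Delta_u=|N_u^+|$. The correlation metric is $d_{uv}=1-\frac{|N_u^+\cap N_v^+|}{|N_u^+\cup N_v^+|}$. The adjusted correlation metric $f$: (1) set $f=d$; (2) for every negative edge $(u,v)$ with $d_{uv}>0.7$ set $f_{uv}=1$; (3) for every $u$ with $|N_u^-\cap\{v: d_{uv}\le 0.7\}|\ge\frac{10}{3}\Delta_u$, set $f_{uv}=1$ for all $v\ne u$. A clustering is a partition of $V$; a positive edge is a disagreement if its endpoints are in different clusters, a negative edge if in the same cluster; $y_{\mathcal{C}}(u)$ counts disagreements at $u$; $\mathsf{OPT}(\infty)=\min_{\mathcal{C}}\max_u y_{\mathcal{C}}(u)$. -}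

module Defs where

open import Data.Bool using (Bool; true; false; if_then_else_; _∧_; _∨_; not; _xor_)
open import Data.Nat as ℕ using (ℕ; zero; suc; _⊔_; NonZero)
open import Data.Fin using (Fin; zero; suc; _≟_)
open import Data.Integer using (+_)
open import Data.Rational using (ℚ; 0ℚ; 1ℚ; _/_; _≤ᵇ_) renaming (_+_ to _+ℚ_; _-_ to _-ℚ_; _*_ to _*ℚ_)
open import Data.Product using (Σ; ∃; _×_; _,_)
open import Relation.Nullary.Decidable using (does; ⌊_⌋)
open import Relation.Binary.PropositionalEquality using (_≡_; refl)

-- A complete signed graph on vertex set Fin n: sign u v = true iff (u,v) is positive.
record SignedGraph (n : ℕ) : Set where
  field
    sign     : Fin n → Fin n → Bool
    sign-sym : ∀ u v → sign u v ≡ sign v u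
    selfloop : ∀ u → sign u u ≡ true
open SignedGraph public

count : ∀ {n} → (Fin n → Bool) → ℕ
count {zero}  p = 0
count {suc n} p = (if p zero then 1 else 0) ℕ.+ count (λ i → p (suc i))

sumℚ : ∀ {n} → (Fin n → ℚ) → ℚ
sumℚ {zero}  f = 0ℚ
sumℚ {suc n} f = f zero +ℚ sumℚ (λ i → f (suc i))

maxℕ : ∀ {n} → (Fin n → ℕ) → ℕ
maxℕ {zero}  f = 0
maxℕ {suc n} f = f zero ⊔ maxℕ (λ i → f (suc i))

count-nonZero : ∀ {n} (p : Fin n → Bool) (i : Fin n) → p i ≡ true → NonZero (count p)
count-nonZero p zero eq with p zero
count-nonZero p zero refl | true = _
count-nonZero p (suc i) eq with p zero
... | true  = _
... | false = count-nonZero (λ j → p (suc j)) i eq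

module _ {n : ℕ} (G : SignedGraph n) where

  pos : Fin n → Fin n → Bool
  pos = sign G

  neg : Fin n → Fin n → Bool
  neg u v = not (sign G u v)

  Δ : Fin n → ℕ
  Δ u = count (pos u)

  interCount : Fin n → Fin n → ℕ
  interCount u v = count (λ w → pos u w ∧ pos v w)

  unionCount : Fin n → Fin n → ℕ
  unionCount u v = count (λ w → pos u w ∨ pos v w)

  unionNonZero : ∀ u v → NonZero (unionCount u v)
  unionNonZero u v = count-nonZero (λ w → pos u w ∨ pos v w) u (lem (sign G u u) (selfloop G u))
    where
    lem : ∀ b → b ≡ true → (b ∨ pos v u) ≡ true
    lem true refl = refl

  d : Fin n → Fin n → ℚ
  d u v = 1ℚ -ℚ ((+ interCount u v) / unionCount u v) {{unionNonZero u v}}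

  seven-tenths : ℚ
  seven-tenths = + 7 / 10

  close : Fin n → Fin n → Bool
  close u v = d u v ≤ᵇ seven-tenths

  bad : Fin n → Bool
  bad u = (10 ℕ.* Δ u) ℕ.≤ᵇ (3 ℕ.* count (λ v → neg u v ∧ close u v))

  f : Fin n → Fin n → ℚ
  f u v =
    if not ⌊ u ≟ v ⌋ ∧ (bad u ∨ bad v) then 1ℚ
    else if neg u v ∧ not (close u v) then 1ℚ
    else d u v

  fracCost : Fin n → ℚ
  fracCost u = sumℚ (λ v → if pos u v then f u v else (1ℚ -ℚ f u v))

  -- a clustering is given by a cluster label for each vertex
  Clustering : Set
  Clustering = Fin n → Fin n

  sameCluster : Clustering → Fin n → Fin n → Bool
  sameCluster C u v = ⌊ C u ≟ C v ⌋

  y : Clustering → Fin n → ℕ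
  y C u = count (λ v → pos u v xor sameCluster C u v)

  maxDisagree : Clustering → ℕ
  maxDisagree C = maxℕ (y C)

  IsOPT∞ : ℕ → Set
  IsOPT∞ k = (∃ λ C → maxDisagree C ≡ k) × (∀ C → k ℕ.≤ maxDisagree C)

{-# OPTIONS --safe #-}
-- Fix a clustering C with at most k = OPT(∞) disagreements at every vertex; only this half
-- of optimality is used. Two vertices in different clusters share at most 2k positive
-- neighbours, and two vertices in the same cluster differ in at most 2k of them. Hence a vertex
-- with a close (d ≤ 0.7) neighbour in another cluster has 3Δ ≤ 20k, and so does a bad vertex;
-- a vertex in the cluster of a bad vertex has 3Δ ≤ 26k; and inside a cluster d_uv ≤ 2k/Δ_u.
-- At a vertex u that is not bad, each term of the fractional cost is charged either 1 (a
-- disagreement, a bad positive neighbour in u's cluster, or a close negative neighbour in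
-- another cluster: at most k + 26k/3 + 200k/9 ≤ 54k terms) or 2k/Δ_u (a good positive
-- neighbour in u's cluster: at most Δ_u terms), for a total of 56k. At a bad vertex f makes
-- every negative term vanish, and the Δ_u ≤ 20k/3 positive terms are at most 1 each.
module Submission where

open import Defs
open import Data.Nat using (ℕ)
open import Data.Fin using (Fin)
open import Data.Integer using (+_)
open import Data.Rational using (_≤_; _*_; _/_)

open import Algebra.Bundles using (CommutativeMonoid)
import Algebra.Properties.CommutativeSemigroup as CommSemigroupProperties
open import Data.Bool using (Bool; true; false; T; if_then_else_; _∧_; _∨_; not; _xor_)
open import Data.Bool.Properties using (∧-zeroʳ; if-eta; not-¬; T-≡; T-∧; T-∨)
open import Data.Empty using (⊥-elim)
open import Data.Fin using (zero; suc; _≟_)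
import Data.Integer as ℤ
open import Data.Integer.Properties using (pos-+; pos-*; drop‿+≤+)
open import Data.Nat as ℕ using (zero; suc; z≤n; NonZero)
import Data.Nat.Properties as ℕ
open import Data.Nat.Tactic.RingSolver using (solve-∀)
open import Data.Product as Product using (∃; _,_; proj₁; proj₂)
open import Data.Rational using (ℚ; 0ℚ; 1ℚ; _+_; _-_; -_; toℚᵘ)
open import Data.Rational.Properties as ℚ
  using ( toℚᵘ-fromℚᵘ; toℚᵘ-injective; toℚᵘ-homo-+; toℚᵘ-homo-*; toℚᵘ-mono-≤; toℚᵘ-cancel-≤
        ; /-cong; normalize-nonNeg; nonNegative⁻¹; neg-antimono-≤; +-monoʳ-≤; +-monoˡ-≤; +-mono-≤
        ; +-identityˡ; *-identityʳ; ≤ᵇ⇒≤; +-0-commutativeMonoid)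
open import Data.Rational.Solver using (module +-*-Solver)
open import Data.Rational.Unnormalised as ℚᵘ using (mkℚᵘ; *≤*)
  renaming (_/_ to _/ᵘ_; _≃_ to _≃ᵘ_; _≤_ to _≤ᵘ_)
import Data.Rational.Unnormalised.Properties as ℚᵘ
open import Data.Sum as Sum using (_⊎_; inj₁; inj₂)
open import Function.Base using (_∘_; id)
open import Function.Bundles using (_⇔_; mk⇔; Equivalence)
open import Function.Related.Propositional using (module EquationalReasoning)
open import Relation.Binary.PropositionalEquality
open import Relation.Nullary.Decidable
  using (⌊_⌋; yes; no; toWitness; toWitnessFalse; dec-false; isYes≗does)

open Equivalence using (to; from)

-- Rationals with natural-number numerators

toℚᵘ-/ : ∀ i b .{{_ : NonZero b}} → toℚᵘ (i / b) ≃ᵘ i /ᵘ b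
toℚᵘ-/ i (suc b) = toℚᵘ-fromℚᵘ (mkℚᵘ i b)

/≤/⇔ : ∀ a b c e .{{_ : NonZero b}} .{{_ : NonZero e}} →
       (+ a / b ≤ + c / e) ⇔ (a ℕ.* e ℕ.≤ c ℕ.* b)
/≤/⇔ a b@(suc _) c e@(suc _) = mk⇔
  (λ a/b≤c/e → cross (ℚᵘ.≤-respˡ-≃ (toℚᵘ-/ (+ a) b) (ℚᵘ.≤-respʳ-≃ (toℚᵘ-/ (+ c) e) (toℚᵘ-mono-≤ a/b≤c/e))))
  (λ ae≤cb → toℚᵘ-cancel-≤ (ℚᵘ.≤-respˡ-≃ (ℚᵘ.≃-sym (toℚᵘ-/ (+ a) b))
    (ℚᵘ.≤-respʳ-≃ (ℚᵘ.≃-sym (toℚᵘ-/ (+ c) e)) (*≤* (subst₂ ℤ._≤_ (pos-* a e) (pos-* c b) (ℤ.+≤+ ae≤cb))))))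
  where
  cross : + a /ᵘ b ≤ᵘ + c /ᵘ e → a ℕ.* e ℕ.≤ c ℕ.* b
  cross (*≤* le) = drop‿+≤+ (subst₂ ℤ._≤_ (sym (pos-* a e)) (sym (pos-* c b)) le)

/+/ : ∀ a b c e .{{_ : NonZero b}} .{{_ : NonZero e}} →
      + a / b + + c / e ≡ (+ (a ℕ.* e ℕ.+ c ℕ.* b) / (b ℕ.* e)) {{ℕ.m*n≢0 b e}}
/+/ a b@(suc _) c e@(suc _) = toℚᵘ-injective (begin
  toℚᵘ (+ a / b + + c / e)               ≈⟨ toℚᵘ-homo-+ (+ a / b) (+ c / e) ⟩
  toℚᵘ (+ a / b) ℚᵘ.+ toℚᵘ (+ c / e)     ≈⟨ ℚᵘ.+-cong (toℚᵘ-/ (+ a) b) (toℚᵘ-/ (+ c) e) ⟩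
  + a /ᵘ b ℚᵘ.+ + c /ᵘ e                 ≡⟨ cong (_/ᵘ (b ℕ.* e)) numerator ⟩
  + (a ℕ.* e ℕ.+ c ℕ.* b) /ᵘ (b ℕ.* e)   ≈⟨ ℚᵘ.≃-sym (toℚᵘ-/ (+ (a ℕ.* e ℕ.+ c ℕ.* b)) (b ℕ.* e)) ⟩
  toℚᵘ (+ (a ℕ.* e ℕ.+ c ℕ.* b) / (b ℕ.* e)) ∎)
  where
  open ℚᵘ.≃-Reasoning
  numerator : + a ℤ.* + e ℤ.+ + c ℤ.* + b ≡ + (a ℕ.* e ℕ.+ c ℕ.* b)
  numerator = sym (trans (pos-+ (a ℕ.* e) (c ℕ.* b)) (cong₂ ℤ._+_ (pos-* a e) (pos-* c b)))

/*/ : ∀ a b c e .{{_ : NonZero b}} .{{_ : NonZero e}} →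
      + a / b * (+ c / e) ≡ (+ (a ℕ.* c) / (b ℕ.* e)) {{ℕ.m*n≢0 b e}}
/*/ a b@(suc _) c e@(suc _) = toℚᵘ-injective (begin
  toℚᵘ (+ a / b * (+ c / e))             ≈⟨ toℚᵘ-homo-* (+ a / b) (+ c / e) ⟩
  toℚᵘ (+ a / b) ℚᵘ.* toℚᵘ (+ c / e)     ≈⟨ ℚᵘ.*-cong (toℚᵘ-/ (+ a) b) (toℚᵘ-/ (+ c) e) ⟩
  + a /ᵘ b ℚᵘ.* (+ c /ᵘ e)               ≡⟨ cong (_/ᵘ (b ℕ.* e)) (sym (pos-* a c)) ⟩
  + (a ℕ.* c) /ᵘ (b ℕ.* e)               ≈⟨ ℚᵘ.≃-sym (toℚᵘ-/ (+ (a ℕ.* c)) (b ℕ.* e)) ⟩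
  toℚᵘ (+ (a ℕ.* c) / (b ℕ.* e))         ∎)
  where open ℚᵘ.≃-Reasoning

-≤⇔≤+ : ∀ p q r → (p - q ≤ r) ⇔ (p ≤ q + r)
-≤⇔≤+ p q r = mk⇔
  (λ h → subst (_≤ q + r) (solve 2 (λ p q → q :+ (p :- q) := p) refl p q) (+-monoʳ-≤ q h))
  (λ h → subst (p - q ≤_) (solve 2 (λ q r → (q :+ r) :- q := r) refl q r) (+-monoˡ-≤ (- q) h))
  where open +-*-Solver

1-/≤/⇔ : ∀ a b c e .{{_ : NonZero b}} .{{_ : NonZero e}} →
         (1ℚ - + a / b ≤ + c / e) ⇔ (b ℕ.* e ℕ.≤ a ℕ.* e ℕ.+ c ℕ.* b)
1-/≤/⇔ a b c e = begin
  1ℚ - + a / b ≤ + c / e                ∼⟨ -≤⇔≤+ 1ℚ (+ a / b) (+ c / e) ⟩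
  1ℚ ≤ + a / b + + c / e                ≡⟨ cong (1ℚ ≤_) (/+/ a b c e) ⟩
  1ℚ ≤ (+ m / (b ℕ.* e)) {{be≢0}}       ∼⟨ /≤/⇔ 1 1 m (b ℕ.* e) {{_}} {{be≢0}} ⟩
  1 ℕ.* (b ℕ.* e) ℕ.≤ m ℕ.* 1           ≡⟨ cong₂ ℕ._≤_ (ℕ.*-identityˡ (b ℕ.* e)) (ℕ.*-identityʳ m) ⟩
  b ℕ.* e ℕ.≤ m                         ∎
  where
  open EquationalReasoning
  m = a ℕ.* e ℕ.+ c ℕ.* b
  be≢0 = ℕ.m*n≢0 b e

1-p≤1 : ∀ {p} → 0ℚ ≤ p → 1ℚ - p ≤ 1ℚ
1-p≤1 0≤p = +-monoʳ-≤ 1ℚ (neg-antimono-≤ 0≤p)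

0≤1-p : ∀ {p} → p ≤ 1ℚ → 0ℚ ≤ 1ℚ - p
0≤1-p p≤1 = +-monoʳ-≤ 1ℚ (neg-antimono-≤ p≤1)

fromℕ : ℕ → ℚ
fromℕ m = + m / 1

fromℕ-+ : ∀ m n → fromℕ m + fromℕ n ≡ fromℕ (m ℕ.+ n)
fromℕ-+ m n = trans (/+/ m 1 n 1) (/-cong (cong +_ (cong₂ ℕ._+_ (ℕ.*-identityʳ m) (ℕ.*-identityʳ n))) refl)

fromℕ-* : ∀ m n → fromℕ m * fromℕ n ≡ fromℕ (m ℕ.* n)
fromℕ-* m n = /*/ m 1 n 1

fromℕ-mono-≤ : ∀ {m n} → m ℕ.≤ n → fromℕ m ≤ fromℕ n
fromℕ-mono-≤ {m} {n} m≤n =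
  from (/≤/⇔ m 1 n 1) (subst₂ ℕ._≤_ (sym (ℕ.*-identityʳ m)) (sym (ℕ.*-identityʳ n)) m≤n)

fromℕ*/≤ : ∀ m c e .{{_ : NonZero e}} → m ℕ.≤ e → fromℕ m * (+ c / e) ≤ fromℕ c
fromℕ*/≤ m c e m≤e = subst (_≤ fromℕ c) (sym (/*/ m 1 c e))
  (from (/≤/⇔ (m ℕ.* c) (1 ℕ.* e) c 1 {{ℕ.m*n≢0 1 e}}) (subst₂ ℕ._≤_ (mc≡ m c) (ec≡ e c) (ℕ.*-monoˡ-≤ c m≤e)))
  where
  mc≡ : ∀ m c → m ℕ.* c ≡ m ℕ.* c ℕ.* 1
  mc≡ = solve-∀
  ec≡ : ∀ e c → e ℕ.* c ≡ c ℕ.* (1 ℕ.* e)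
  ec≡ = solve-∀
-- Counting and summing over Fin n

if-preserves : ∀ {a ℓ} {A : Set a} (P : A → Set ℓ) {b x y} → P x → P y → P (if b then x else y)
if-preserves P {true}  px _  = px
if-preserves P {false} _  py = py

indicator-mono : ∀ {a b} → (T a → T b) → (if a then 1 else 0) ℕ.≤ (if b then 1 else 0)
indicator-mono {false}         _   = z≤n
indicator-mono {true}  {true}  _   = ℕ.≤-refl
indicator-mono {true}  {false} a⇒b = ⊥-elim (a⇒b _)

indicator-∨ : ∀ a b → (if a ∨ b then 1 else 0) ℕ.≤ (if a then 1 else 0) ℕ.+ (if b then 1 else 0)
indicator-∨ true  _ = ℕ.m≤m+n 1 _
indicator-∨ false _ = ℕ.≤-refl

count-mono : ∀ {n} {p q : Fin n → Bool} → (∀ i → T (p i) → T (q i)) → count p ℕ.≤ count q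
count-mono {zero}  _   = z≤n
count-mono {suc n} p⊆q = ℕ.+-mono-≤ (indicator-mono (p⊆q zero)) (count-mono (p⊆q ∘ suc))

count-∨ : ∀ {n} (p q : Fin n → Bool) → count (λ i → p i ∨ q i) ℕ.≤ count p ℕ.+ count q
count-∨ {zero}  p q = z≤n
count-∨ {suc n} p q = ℕ.≤-trans
  (ℕ.+-mono-≤ (indicator-∨ (p zero) (q zero)) (count-∨ (p ∘ suc) (q ∘ suc)))
  (ℕ.≤-reflexive (interchange [p0] [q0] (count (p ∘ suc)) (count (q ∘ suc))))
  where
  open CommSemigroupProperties ℕ.+-commutativeSemigroup using (interchange)
  [p0] = if p zero then 1 else 0
  [q0] = if q zero then 1 else 0

count≡0⊎∃ : ∀ {n} (p : Fin n → Bool) → count p ≡ 0 ⊎ ∃ λ i → T (p i)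
count≡0⊎∃ {zero}  p = inj₁ refl
count≡0⊎∃ {suc n} p with p zero in p0
... | true  = inj₂ (zero , from T-≡ p0)
... | false = Sum.map₂ (Product.map suc id) (count≡0⊎∃ (p ∘ suc))

count-bound-via-witness : ∀ {n} (p : Fin n → Bool) m {r} →
                          ((∃ λ i → T (p i)) → m ℕ.* count p ℕ.≤ r) → m ℕ.* count p ℕ.≤ r
count-bound-via-witness p m {r} bound = Sum.[ none , bound ]′ (count≡0⊎∃ p)
  where
  none : count p ≡ 0 → m ℕ.* count p ℕ.≤ r
  none p≡0 rewrite p≡0 | ℕ.*-zeroʳ m = z≤n

≤maxℕ : ∀ {n} (g : Fin n → ℕ) i → g i ℕ.≤ maxℕ g
≤maxℕ g zero    = ℕ.m≤m⊔n (g zero) (maxℕ (g ∘ suc))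
≤maxℕ g (suc i) = ℕ.≤-trans (≤maxℕ (g ∘ suc) i) (ℕ.m≤n⊔m (g zero) (maxℕ (g ∘ suc)))

sumℚ-mono : ∀ {n} {g h : Fin n → ℚ} → (∀ i → g i ≤ h i) → sumℚ g ≤ sumℚ h
sumℚ-mono {zero}  _   = ℚ.≤-refl
sumℚ-mono {suc n} g≤h = +-mono-≤ (g≤h zero) (sumℚ-mono (g≤h ∘ suc))

sumℚ-+ : ∀ {n} (g h : Fin n → ℚ) → sumℚ (λ i → g i + h i) ≡ sumℚ g + sumℚ h
sumℚ-+ {zero}  g h = refl
sumℚ-+ {suc n} g h = trans (cong (_+_ (g zero + h zero)) (sumℚ-+ (g ∘ suc) (h ∘ suc)))
  (interchange (g zero) (h zero) (sumℚ (g ∘ suc)) (sumℚ (h ∘ suc)))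
  where
  open CommSemigroupProperties (CommutativeMonoid.commutativeSemigroup +-0-commutativeMonoid)
    using (interchange)

sumℚ-indicator : ∀ {n} (p : Fin n → Bool) x → sumℚ (λ i → if p i then x else 0ℚ) ≡ fromℕ (count p) * x
sumℚ-indicator {zero}  p x = sym (ℚ.*-zeroˡ x)
sumℚ-indicator {suc n} p x with p zero
... | true  = begin
  x + sumℚ (λ i → if p (suc i) then x else 0ℚ)  ≡⟨ cong (_+_ x) (sumℚ-indicator (p ∘ suc) x) ⟩
  x + fromℕ m * x                               ≡⟨ x+yx≡[1+y]x x (fromℕ m) ⟩
  (1ℚ + fromℕ m) * x                            ≡⟨ cong (_* x) (fromℕ-+ 1 m) ⟩
  fromℕ (suc m) * x                             ∎
  where
  open ≡-Reasoning
  m = count (p ∘ suc)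
  x+yx≡[1+y]x : ∀ x y → x + y * x ≡ (1ℚ + y) * x
  x+yx≡[1+y]x = solve 2 (λ x y → x :+ y :* x := (con 1ℚ :+ y) :* x) refl
    where open +-*-Solver
... | false = trans (+-identityˡ _) (sumℚ-indicator (p ∘ suc) x)

edgeCost : Bool → ℚ → ℚ
edgeCost positive x = if positive then x else 1ℚ - x

edgeCost≤indicator : ∀ positive {x} → x ≤ 1ℚ → (positive ≡ false → x ≡ 1ℚ) →
                     edgeCost positive x ≤ (if positive then 1ℚ else 0ℚ)
edgeCost≤indicator true  x≤1 _   = x≤1
edgeCost≤indicator false _   x≡1 = ℚ.≤-reflexive (cong (_-_ 1ℚ) (x≡1 refl))

edgeCost≤charges : ∀ positive together isBad isClose {x y} → 0ℚ ≤ x → x ≤ 1ℚ →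
  (positive ≡ true → together ≡ true → isBad ≡ false → x ≤ y) →
  (positive ≡ false → together ≡ false → isClose ≡ false → x ≡ 1ℚ) →
  edgeCost positive x
    ≤ (if (positive xor together)
          ∨ ((positive ∧ together ∧ isBad) ∨ (not positive ∧ not together ∧ isClose))
       then 1ℚ else 0ℚ)
      + (if positive ∧ together ∧ not isBad then y else 0ℚ)
edgeCost≤charges true  false _     _     _   x≤1 _   _   = x≤1
edgeCost≤charges true  true  true  _     _   x≤1 _   _   = x≤1
edgeCost≤charges true  true  false _ {y = y} _ _ x≤y _   =
  ℚ.≤-trans (x≤y refl refl refl) (ℚ.≤-reflexive (sym (+-identityˡ y)))
edgeCost≤charges false true  _     _     0≤x _   _   _   = 1-p≤1 0≤x
edgeCost≤charges false false _     true  0≤x _   _   _   = 1-p≤1 0≤x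
edgeCost≤charges false false _     false _   _   _   x≡1 =
  ℚ.≤-reflexive (cong (_-_ 1ℚ) (x≡1 refl refl refl))

-- The correlation metric and its adjustment f

module _ {n : ℕ} (G : SignedGraph n) where

  inter≤union : ∀ u v → interCount G u v ℕ.≤ unionCount G u v
  inter≤union u v = count-mono (λ x → from (T-∨ {pos G u x} {pos G v x}) ∘ inj₁ ∘ proj₁ ∘ to T-∧)

  inter≤Δʳ : ∀ u v → interCount G u v ℕ.≤ Δ G v
  inter≤Δʳ u v = count-mono (λ x → proj₂ ∘ to (T-∧ {pos G u x} {pos G v x}))

  Δ≤union : ∀ u v → Δ G u ℕ.≤ unionCount G u v
  Δ≤union u v = count-mono (λ x → from (T-∨ {pos G u x} {pos G v x}) ∘ inj₁)

  Δ-nonZero : ∀ u → NonZero (Δ G u)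
  Δ-nonZero u = count-nonZero (pos G u) u (selfloop G u)

  d≤1 : ∀ u v → d G u v ≤ 1ℚ
  d≤1 u v = 1-p≤1 {I/U} (nonNegative⁻¹ I/U {{normalize-nonNeg (interCount G u v) (unionCount G u v)}})
    where
    instance _ = unionNonZero G u v
    I/U = + interCount G u v / unionCount G u v

  0≤d : ∀ u v → 0ℚ ≤ d G u v
  0≤d u v = 0≤1-p {I/U} (from (/≤/⇔ (interCount G u v) (unionCount G u v) 1 1)
    (subst₂ ℕ._≤_ (sym (ℕ.*-identityʳ _)) (sym (ℕ.*-identityˡ _)) (inter≤union u v)))
    where
    instance _ = unionNonZero G u v
    I/U = + interCount G u v / unionCount G u v

  close⇒3union≤10inter : ∀ u v → T (close G u v) → 3 ℕ.* unionCount G u v ℕ.≤ 10 ℕ.* interCount G u v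
  close⇒3union≤10inter u v d≤7/10 = ℕ.+-cancelˡ-≤ (7 ℕ.* U) (3 ℕ.* U) (10 ℕ.* I)
    (subst₂ ℕ._≤_ (lhs U) (rhs U I) (to (1-/≤/⇔ I U 7 10 {{unionNonZero G u v}}) (≤ᵇ⇒≤ d≤7/10)))
    where
    I = interCount G u v
    U = unionCount G u v
    lhs : ∀ U → U ℕ.* 10 ≡ 7 ℕ.* U ℕ.+ 3 ℕ.* U
    lhs = solve-∀
    rhs : ∀ U I → I ℕ.* 10 ℕ.+ 7 ℕ.* U ≡ 7 ℕ.* U ℕ.+ 10 ℕ.* I
    rhs = solve-∀

  badEndpoint farNegative : Fin n → Fin n → Bool
  badEndpoint u v = not ⌊ u ≟ v ⌋ ∧ (bad G u ∨ bad G v)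
  farNegative u v = neg G u v ∧ not (close G u v)

  -- Evaluating f through these equations, rather than by rewriting, keeps Agda from
  -- normalising d into gcd computations.
  f-by-tests : ∀ {u v a b} → badEndpoint u v ≡ a → farNegative u v ≡ b →
               f G u v ≡ (if a then 1ℚ else if b then 1ℚ else d G u v)
  f-by-tests refl refl = refl

  f-cases : ∀ u v (P : ℚ → Set) → P 1ℚ → P (d G u v) → P (f G u v)
  f-cases u v P P1 Pd = if-preserves P {badEndpoint u v} P1 (if-preserves P {farNegative u v} P1 Pd)

  f≤1 : ∀ u v → f G u v ≤ 1ℚ
  f≤1 u v = f-cases u v (_≤ 1ℚ) ℚ.≤-refl (d≤1 u v)

  0≤f : ∀ u v → 0ℚ ≤ f G u v
  0≤f u v = f-cases u v (0ℚ ≤_) (nonNegative⁻¹ 1ℚ) (0≤d u v)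

  f-far≡1 : ∀ u v → neg G u v ≡ true → close G u v ≡ false → f G u v ≡ 1ℚ
  f-far≡1 u v negative far =
    trans (f-by-tests {u} {v} refl (cong₂ _∧_ negative (cong not far))) (if-eta (badEndpoint u v))

  f-bad-neg≡1 : ∀ u v → bad G u ≡ true → pos G u v ≡ false → f G u v ≡ 1ℚ
  f-bad-neg≡1 u v b negative = f-by-tests {u} {v}
    (cong₂ (λ e bu → not e ∧ (bu ∨ bad G v)) (trans (isYes≗does (u ≟ v)) (dec-false (u ≟ v) u≢v)) b) refl
    where
    u≢v : u ≢ v
    u≢v refl = not-¬ (selfloop G u) negative

  f-pos≡d : ∀ u v → pos G u v ≡ true → bad G u ≡ false → bad G v ≡ false → f G u v ≡ d G u v
  f-pos≡d u v positive bu bv = f-by-tests {u} {v}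
    (trans (cong₂ (λ x y → not ⌊ u ≟ v ⌋ ∧ (x ∨ y)) bu bv) (∧-zeroʳ (not ⌊ u ≟ v ⌋)))
    (cong (λ s → not s ∧ not (close G u v)) positive)

-- A clustering with at most k disagreements at every vertex

module _ {n : ℕ} (G : SignedGraph n) (C : Clustering G) (k : ℕ) (y≤k : ∀ w → y G C w ℕ.≤ k) where

  open CommSemigroupProperties ℕ.*-commutativeSemigroup using (x∙yz≈y∙xz)

  disagrees : Fin n → Fin n → Bool
  disagrees w x = pos G w x xor sameCluster G C w x

  pair-disagreements≤2k : ∀ w v → count (λ x → disagrees w x ∨ disagrees v x) ℕ.≤ k ℕ.+ k
  pair-disagreements≤2k w v = ℕ.≤-trans (count-∨ (disagrees w) (disagrees v)) (ℕ.+-mono-≤ (y≤k w) (y≤k v))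

  separated⇒inter≤2k : ∀ {w v} → C w ≢ C v → interCount G w v ℕ.≤ k ℕ.+ k
  separated⇒inter≤2k {w} {v} w≢v = ℕ.≤-trans (count-mono common⇒disagrees) (pair-disagreements≤2k w v)
    where
    common⇒disagrees : ∀ x → T (pos G w x ∧ pos G v x) → T (disagrees w x ∨ disagrees v x)
    common⇒disagrees x with pos G w x | pos G v x | C w ≟ C x | C v ≟ C x
    ... | true  | true  | yes wx | yes vx = λ _ → w≢v (trans wx (sym vx))
    ... | true  | true  | no _   | _      = _
    ... | true  | true  | yes _  | no _   = _
    ... | true  | false | _      | _      = λ ()
    ... | false | _     | _      | _      = λ ()

  together⇒union≤inter+2k : ∀ {w v} → C w ≡ C v → unionCount G w v ℕ.≤ interCount G w v ℕ.+ (k ℕ.+ k)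
  together⇒union≤inter+2k {w} {v} w≡v = ℕ.≤-trans (count-mono split)
    (ℕ.≤-trans (count-∨ (λ x → pos G w x ∧ pos G v x) (λ x → disagrees w x ∨ disagrees v x))
      (ℕ.+-monoʳ-≤ (interCount G w v) (pair-disagreements≤2k w v)))
    where
    split : ∀ x → T (pos G w x ∨ pos G v x) → T ((pos G w x ∧ pos G v x) ∨ (disagrees w x ∨ disagrees v x))
    split x with pos G w x | pos G v x | C w ≟ C x | C v ≟ C x
    ... | true  | true  | _      | _      = _
    ... | false | false | _      | _      = λ ()
    ... | _     | _     | yes wx | no ¬vx = ⊥-elim (¬vx (trans (sym w≡v) wx))
    ... | _     | _     | no ¬wx | yes vx = ⊥-elim (¬wx (trans w≡v vx))
    ... | true  | false | yes _  | yes _  = _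
    ... | true  | false | no _   | no _   = _
    ... | false | true  | yes _  | yes _  = _
    ... | false | true  | no _   | no _   = _

  together⇒Δ≤Δ+2k : ∀ {u v} → C u ≡ C v → Δ G u ℕ.≤ Δ G v ℕ.+ (k ℕ.+ k)
  together⇒Δ≤Δ+2k {u} {v} u≡v = ℕ.≤-trans (Δ≤union G u v)
    (ℕ.≤-trans (together⇒union≤inter+2k u≡v) (ℕ.+-monoˡ-≤ (k ℕ.+ k) (inter≤Δʳ G u v)))

  together⇒d≤2k/Δ : ∀ {u v} → C u ≡ C v → d G u v ≤ (+ (k ℕ.+ k) / Δ G u) {{Δ-nonZero G u}}
  together⇒d≤2k/Δ {u} {v} u≡v =
    from (1-/≤/⇔ I U (k ℕ.+ k) (Δ G u) {{unionNonZero G u v}} {{Δ-nonZero G u}}) (begin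
    U ℕ.* Δ G u                                ≤⟨ ℕ.*-monoˡ-≤ (Δ G u) (together⇒union≤inter+2k u≡v) ⟩
    (I ℕ.+ (k ℕ.+ k)) ℕ.* Δ G u                ≡⟨ ℕ.*-distribʳ-+ (Δ G u) I (k ℕ.+ k) ⟩
    I ℕ.* Δ G u ℕ.+ (k ℕ.+ k) ℕ.* Δ G u
      ≤⟨ ℕ.+-monoʳ-≤ (I ℕ.* Δ G u) (ℕ.*-monoʳ-≤ (k ℕ.+ k) (Δ≤union G u v)) ⟩
    I ℕ.* Δ G u ℕ.+ (k ℕ.+ k) ℕ.* U            ∎)
    where
    open ℕ.≤-Reasoning
    I = interCount G u v
    U = unionCount G u v

  closeNeg separatedClose : Fin n → Fin n → Bool
  closeNeg w v = neg G w v ∧ close G w v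
  separatedClose w v = neg G w v ∧ not (sameCluster G C w v) ∧ close G w v

  separatedClose⇒3Δ≤20k : ∀ w v → T (separatedClose w v) → 3 ℕ.* Δ G w ℕ.≤ 20 ℕ.* k
  separatedClose⇒3Δ≤20k w v sc = begin
    3 ℕ.* Δ G w                 ≤⟨ ℕ.*-monoʳ-≤ 3 (Δ≤union G w v) ⟩
    3 ℕ.* unionCount G w v      ≤⟨ close⇒3union≤10inter G w v (proj₂ separated×close) ⟩
    10 ℕ.* interCount G w v     ≤⟨ ℕ.*-monoʳ-≤ 10 (separated⇒inter≤2k (toWitnessFalse (proj₁ separated×close))) ⟩
    10 ℕ.* (k ℕ.+ k)            ≡⟨ 10[k+k]≡20k k ⟩
    20 ℕ.* k                    ∎
    where
    open ℕ.≤-Reasoning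
    separated×close = to (T-∧ {not (sameCluster G C w v)} {close G w v}) (proj₂ (to (T-∧ {neg G w v}) sc))
    10[k+k]≡20k : ∀ k → 10 ℕ.* (k ℕ.+ k) ≡ 20 ℕ.* k
    10[k+k]≡20k = solve-∀

  closeNeg≤k+separatedClose : ∀ w → count (closeNeg w) ℕ.≤ k ℕ.+ count (separatedClose w)
  closeNeg≤k+separatedClose w = ℕ.≤-trans
    (count-mono (λ x → split (pos G w x) (sameCluster G C w x) (close G w x)))
    (ℕ.≤-trans (count-∨ (disagrees w) (separatedClose w)) (ℕ.+-monoˡ-≤ (count (separatedClose w)) (y≤k w)))
    where
    split : ∀ positive together close → T (not positive ∧ close) →
            T ((positive xor together) ∨ (not positive ∧ not together ∧ close))
    split false true  _ _  = _
    split false false _ cl = cl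

  -- Either some close negative neighbour of w lies in another cluster, or all of them are
  -- disagreements at w, and then 10Δ ≤ 3k.
  bad⇒3Δ≤20k : ∀ w → T (bad G w) → 3 ℕ.* Δ G w ℕ.≤ 20 ℕ.* k
  bad⇒3Δ≤20k w b =
    Sum.[ none , (λ (v , sc) → separatedClose⇒3Δ≤20k w v sc) ]′ (count≡0⊎∃ (separatedClose w))
    where
    none : count (separatedClose w) ≡ 0 → 3 ℕ.* Δ G w ℕ.≤ 20 ℕ.* k
    none sc≡0 = ℕ.*-cancelˡ-≤ 10 (begin
      10 ℕ.* (3 ℕ.* Δ G w)                            ≡⟨ x∙yz≈y∙xz 10 3 (Δ G w) ⟩
      3 ℕ.* (10 ℕ.* Δ G w)                            ≤⟨ ℕ.*-monoʳ-≤ 3 10Δ≤3closeNeg ⟩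
      3 ℕ.* (3 ℕ.* count (closeNeg w))                ≤⟨ ℕ.*-monoʳ-≤ 3 (ℕ.*-monoʳ-≤ 3 (closeNeg≤k+separatedClose w)) ⟩
      3 ℕ.* (3 ℕ.* (k ℕ.+ count (separatedClose w)))  ≡⟨ cong (λ c → 3 ℕ.* (3 ℕ.* c)) k+sc≡k ⟩
      3 ℕ.* (3 ℕ.* k)                                 ≡⟨ ℕ.*-assoc 3 3 k ⟨
      9 ℕ.* k                                         ≤⟨ ℕ.*-monoˡ-≤ k (ℕ.m≤m+n 9 191) ⟩
      200 ℕ.* k                                       ≡⟨ ℕ.*-assoc 10 20 k ⟩
      10 ℕ.* (20 ℕ.* k)                               ∎)
      where
      open ℕ.≤-Reasoning
      10Δ≤3closeNeg = ℕ.≤ᵇ⇒≤ (10 ℕ.* Δ G w) (3 ℕ.* count (closeNeg w)) b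
      k+sc≡k : k ℕ.+ count (separatedClose w) ≡ k
      k+sc≡k = trans (cong (k ℕ.+_) sc≡0) (ℕ.+-identityʳ k)

  together-bad⇒3Δ≤26k : ∀ {u} v → C u ≡ C v → T (bad G v) → 3 ℕ.* Δ G u ℕ.≤ 26 ℕ.* k
  together-bad⇒3Δ≤26k {u} v u≡v b = begin
    3 ℕ.* Δ G u                   ≤⟨ ℕ.*-monoʳ-≤ 3 (together⇒Δ≤Δ+2k u≡v) ⟩
    3 ℕ.* (Δ G v ℕ.+ (k ℕ.+ k))   ≡⟨ distrib (Δ G v) k ⟩
    3 ℕ.* Δ G v ℕ.+ 6 ℕ.* k       ≤⟨ ℕ.+-monoˡ-≤ (6 ℕ.* k) (bad⇒3Δ≤20k v b) ⟩
    20 ℕ.* k ℕ.+ 6 ℕ.* k          ≡⟨ ℕ.*-distribʳ-+ k 20 6 ⟨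
    26 ℕ.* k                      ∎
    where
    open ℕ.≤-Reasoning
    distrib : ∀ x k → 3 ℕ.* (x ℕ.+ (k ℕ.+ k)) ≡ 3 ℕ.* x ℕ.+ 6 ℕ.* k
    distrib = solve-∀

  not-bad⇒3closeNeg<10Δ : ∀ w → bad G w ≡ false → 3 ℕ.* count (closeNeg w) ℕ.< 10 ℕ.* Δ G w
  not-bad⇒3closeNeg<10Δ w b = ℕ.≰⇒> (λ 10Δ≤3c → subst T b (ℕ.≤⇒≤ᵇ 10Δ≤3c))

  togetherBad unitCharged fractional : Fin n → Fin n → Bool
  togetherBad u v = pos G u v ∧ sameCluster G C u v ∧ bad G v
  unitCharged u v = disagrees u v ∨ (togetherBad u v ∨ separatedClose u v)
  fractional u v = pos G u v ∧ sameCluster G C u v ∧ not (bad G v)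

  3togetherBad≤26k : ∀ u → 3 ℕ.* count (togetherBad u) ℕ.≤ 26 ℕ.* k
  3togetherBad≤26k u = count-bound-via-witness (togetherBad u) 3 λ (v , tb) →
    let together×bad = to (T-∧ {sameCluster G C u v} {bad G v}) (proj₂ (to (T-∧ {pos G u v}) tb)) in
    ℕ.≤-trans (ℕ.*-monoʳ-≤ 3 (count-mono (λ x → proj₁ ∘ to (T-∧ {pos G u x}))))
              (together-bad⇒3Δ≤26k v (toWitness (proj₁ together×bad)) (proj₂ together×bad))

  9separatedClose≤200k : ∀ u → bad G u ≡ false → 9 ℕ.* count (separatedClose u) ℕ.≤ 200 ℕ.* k
  9separatedClose≤200k u b = count-bound-via-witness (separatedClose u) 9 λ (v , sc) → begin
    9 ℕ.* count (separatedClose u)      ≤⟨ ℕ.*-monoʳ-≤ 9 (count-mono separatedClose⇒closeNeg) ⟩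
    9 ℕ.* count (closeNeg u)            ≡⟨ ℕ.*-assoc 3 3 (count (closeNeg u)) ⟩
    3 ℕ.* (3 ℕ.* count (closeNeg u))    ≤⟨ ℕ.*-monoʳ-≤ 3 (ℕ.<⇒≤ (not-bad⇒3closeNeg<10Δ u b)) ⟩
    3 ℕ.* (10 ℕ.* Δ G u)                ≡⟨ x∙yz≈y∙xz 3 10 (Δ G u) ⟩
    10 ℕ.* (3 ℕ.* Δ G u)                ≤⟨ ℕ.*-monoʳ-≤ 10 (separatedClose⇒3Δ≤20k u v sc) ⟩
    10 ℕ.* (20 ℕ.* k)                   ≡⟨ ℕ.*-assoc 10 20 k ⟨
    200 ℕ.* k                           ∎
    where
    open ℕ.≤-Reasoning
    separatedClose⇒closeNeg : ∀ x → T (separatedClose u x) → T (closeNeg u x)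
    separatedClose⇒closeNeg x sc =
      let negative×rest = to (T-∧ {neg G u x}) sc
          isClose = proj₂ (to (T-∧ {not (sameCluster G C u x)}) (proj₂ negative×rest))
      in from (T-∧ {neg G u x}) (proj₁ negative×rest , isClose)

  unitCharged≤54k : ∀ u → bad G u ≡ false → count (unitCharged u) ℕ.≤ 54 ℕ.* k
  unitCharged≤54k u b = bound {a = count (togetherBad u)} {s = count (separatedClose u)}
    (ℕ.≤-trans (count-∨ (disagrees u) (λ v → togetherBad u v ∨ separatedClose u v))
               (ℕ.+-mono-≤ (y≤k u) (count-∨ (togetherBad u) (separatedClose u))))
    (3togetherBad≤26k u) (9separatedClose≤200k u b)
    where
    bound : ∀ {c a s} → c ℕ.≤ k ℕ.+ (a ℕ.+ s) → 3 ℕ.* a ℕ.≤ 26 ℕ.* k → 9 ℕ.* s ℕ.≤ 200 ℕ.* k → c ℕ.≤ 54 ℕ.* k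
    bound {c} {a} {s} c≤ 3a≤ 9s≤ = ℕ.*-cancelˡ-≤ 9 (begin
      9 ℕ.* c                                    ≤⟨ ℕ.*-monoʳ-≤ 9 c≤ ⟩
      9 ℕ.* (k ℕ.+ (a ℕ.+ s))                    ≡⟨ expand k a s ⟩
      9 ℕ.* k ℕ.+ 3 ℕ.* (3 ℕ.* a) ℕ.+ 9 ℕ.* s    ≤⟨ ℕ.+-mono-≤ (ℕ.+-monoʳ-≤ (9 ℕ.* k) (ℕ.*-monoʳ-≤ 3 3a≤)) 9s≤ ⟩
      9 ℕ.* k ℕ.+ 3 ℕ.* (26 ℕ.* k) ℕ.+ 200 ℕ.* k ≡⟨ collect k ⟩
      287 ℕ.* k                                  ≤⟨ ℕ.*-monoˡ-≤ k (ℕ.m≤m+n 287 199) ⟩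
      486 ℕ.* k                                  ≡⟨ ℕ.*-assoc 9 54 k ⟩
      9 ℕ.* (54 ℕ.* k)                           ∎)
      where
      open ℕ.≤-Reasoning
      expand : ∀ k a s → 9 ℕ.* (k ℕ.+ (a ℕ.+ s)) ≡ 9 ℕ.* k ℕ.+ 3 ℕ.* (3 ℕ.* a) ℕ.+ 9 ℕ.* s
      expand = solve-∀
      collect : ∀ k → 9 ℕ.* k ℕ.+ 3 ℕ.* (26 ℕ.* k) ℕ.+ 200 ℕ.* k ≡ 287 ℕ.* k
      collect = solve-∀

  fractional≤Δ : ∀ u → count (fractional u) ℕ.≤ Δ G u
  fractional≤Δ u = count-mono (λ x → proj₁ ∘ to (T-∧ {pos G u x}))

  2k/Δ : Fin n → ℚ
  2k/Δ u = (+ (k ℕ.+ k) / Δ G u) {{Δ-nonZero G u}}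

  good⇒edgeCost≤charges : ∀ u → bad G u ≡ false → ∀ v →
    edgeCost (pos G u v) (f G u v)
      ≤ (if unitCharged u v then 1ℚ else 0ℚ) + (if fractional u v then 2k/Δ u else 0ℚ)
  good⇒edgeCost≤charges u bu v = edgeCost≤charges (pos G u v) (sameCluster G C u v) (bad G v) (close G u v)
    (0≤f G u v) (f≤1 G u v)
    (λ positive together bv → ℚ.≤-trans (ℚ.≤-reflexive (f-pos≡d G u v positive bu bv))
                                        (together⇒d≤2k/Δ (toWitness {a? = C u ≟ C v} (from T-≡ together))))
    (λ negative _ far → f-far≡1 G u v (cong not negative) far)

  fracCost-not-bad : ∀ u → bad G u ≡ false → fracCost G u ≤ fromℕ (56 ℕ.* k)
  fracCost-not-bad u b = begin
    fracCost G u                                           ≤⟨ sumℚ-mono (good⇒edgeCost≤charges u b) ⟩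
    sumℚ (λ v → unit v + frac v)                           ≡⟨ sumℚ-+ unit frac ⟩
    sumℚ unit + sumℚ frac                                  ≡⟨ cong₂ _+_ (sumℚ-indicator (unitCharged u) 1ℚ)
                                                                          (sumℚ-indicator (fractional u) (2k/Δ u)) ⟩
    fromℕ (count (unitCharged u)) * 1ℚ + fromℕ (count (fractional u)) * 2k/Δ u
      ≤⟨ +-mono-≤ (ℚ.≤-trans (ℚ.≤-reflexive (*-identityʳ _)) (fromℕ-mono-≤ (unitCharged≤54k u b)))
                  (fromℕ*/≤ (count (fractional u)) (k ℕ.+ k) (Δ G u) {{Δ-nonZero G u}} (fractional≤Δ u)) ⟩
    fromℕ (54 ℕ.* k) + fromℕ (k ℕ.+ k)                     ≡⟨ fromℕ-+ (54 ℕ.* k) (k ℕ.+ k) ⟩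
    fromℕ (54 ℕ.* k ℕ.+ (k ℕ.+ k))                         ≡⟨ cong fromℕ (54k+2k≡56k k) ⟩
    fromℕ (56 ℕ.* k)                                       ∎
    where
    open ℚ.≤-Reasoning
    unit frac : Fin n → ℚ
    unit v = if unitCharged u v then 1ℚ else 0ℚ
    frac v = if fractional u v then 2k/Δ u else 0ℚ
    54k+2k≡56k : ∀ k → 54 ℕ.* k ℕ.+ (k ℕ.+ k) ≡ 56 ℕ.* k
    54k+2k≡56k = solve-∀

  fracCost-bad : ∀ u → bad G u ≡ true → fracCost G u ≤ fromℕ (56 ℕ.* k)
  fracCost-bad u b = begin
    fracCost G u
      ≤⟨ sumℚ-mono (λ v → edgeCost≤indicator (pos G u v) (f≤1 G u v) (f-bad-neg≡1 G u v b)) ⟩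
    sumℚ (λ v → if pos G u v then 1ℚ else 0ℚ)   ≡⟨ sumℚ-indicator (pos G u) 1ℚ ⟩
    fromℕ (Δ G u) * 1ℚ                          ≡⟨ *-identityʳ (fromℕ (Δ G u)) ⟩
    fromℕ (Δ G u)                               ≤⟨ fromℕ-mono-≤ (ℕ.*-cancelˡ-≤ {Δ G u} {56 ℕ.* k} 3 3Δ≤3[56k]) ⟩
    fromℕ (56 ℕ.* k)                            ∎
    where
    open ℚ.≤-Reasoning
    3Δ≤3[56k] : 3 ℕ.* Δ G u ℕ.≤ 3 ℕ.* (56 ℕ.* k)
    3Δ≤3[56k] = ℕ.≤-trans (bad⇒3Δ≤20k u (from T-≡ b))
      (ℕ.≤-trans (ℕ.*-monoˡ-≤ k (ℕ.m≤m+n 20 148)) (ℕ.≤-reflexive (ℕ.*-assoc 3 56 k)))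

  fracCost≤56k : ∀ u → fracCost G u ≤ fromℕ (56 ℕ.* k)
  fracCost≤56k u = by-badness (bad G u) refl
    where
    -- A with-clause on bad G u would normalise the goal, unfolding d.
    by-badness : ∀ b → bad G u ≡ b → fracCost G u ≤ fromℕ (56 ℕ.* k)
    by-badness true  = fracCost-bad u
    by-badness false = fracCost-not-bad u

lemma3 : ∀ {n : ℕ} (G : SignedGraph n) (opt : ℕ) → IsOPT∞ G opt →
    ∀ (u : Fin n) → fracCost G u ≤ (+ 56 / 1) * (+ opt / 1)
lemma3 G opt ((C , max≡opt) , _) u = subst (fracCost G u ≤_) (sym (fromℕ-* 56 opt))
  (fracCost≤56k G C opt (λ w → subst (y G C w ℕ.≤_) max≡opt (≤maxℕ (y G C) w)) u)
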